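{- The equivalence between validity in the standard semantics and validity in the restricted semantics fails for formulas containing $\Delta$: there exists a propositional formula $A$ containing $\Delta$ that is valid in the restricted semantics but not valid in the standard semantics.
   Context: Propositional Gödel logic over $[0,1]$ with $\Delta$: an interpretation $I$ assigns each variable a value in $[0,1]$ and extends by $I(\bot)=0$, $I(\top)=1$, $\min$ for $\land$, $\max$ for $\lor$, $I(B\to C)=1$ if $I(B)\le I(C)$ and $I(C)$ otherwise, $\neg B := B\to\bot$, $I(\Delta B)=1$ if $I(B)=1$ and $0$ otherwise. Valid in the standard semantics: value $1$ under every interpretation; valid in the restricted semantics: value $1$ under every interpretation with $I(p)<1$ for every propositional variable $p$. -}

module Defs where

open import Level using (0ℓ)
open import Data.Nat using (ℕ)
open import Relation.Nullary using (¬_; yes; no)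
open import Relation.Binary.Bundles using (DecTotalOrder)

data Fm : Set where
  var  : ℕ → Fm
  ⊥f   : Fm
  ⊤f   : Fm
  _∧f_ : Fm → Fm → Fm
  _∨f_ : Fm → Fm → Fm
  _⇒f_ : Fm → Fm → Fm
  Δf   : Fm → Fm

¬f : Fm → Fm
¬f B = B ⇒f ⊥f

data ContainsΔ : Fm → Set where
  here : ∀ {B} → ContainsΔ (Δf B)
  ∧ₗ : ∀ {B C} → ContainsΔ B → ContainsΔ (B ∧f C)
  ∧ᵣ : ∀ {B C} → ContainsΔ C → ContainsΔ (B ∧f C)
  ∨ₗ : ∀ {B C} → ContainsΔ B → ContainsΔ (B ∨f C)
  ∨ᵣ : ∀ {B C} → ContainsΔ C → ContainsΔ (B ∨f C)
  ⇒ₗ : ∀ {B C} → ContainsΔ B → ContainsΔ (B ⇒f C)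
  ⇒ᵣ : ∀ {B C} → ContainsΔ C → ContainsΔ (B ⇒f C)
  Δ↓ : ∀ {B} → ContainsΔ B → ContainsΔ (Δf B)

-- A truth-value chain: a (decidable) linear order with least element 0
-- and greatest element 1, 0 ≠ 1.  The real unit interval [0,1] with its
-- usual order is an instance (no reals exist in agda-stdlib).
record Chain : Set₁ where
  field
    order : DecTotalOrder 0ℓ 0ℓ 0ℓ
  open DecTotalOrder order public
  field
    zero  : Carrier
    one   : Carrier
    zero-least  : ∀ x → zero ≤ x
    one-greatest : ∀ x → x ≤ one
    zero≉one : ¬ (zero ≈ one)

module Sem (T : Chain) where
  open Chain T

  min max : Carrier → Carrier → Carrier
  min x y with x ≤? y
  ... | yes _ = x
  ... | no  _ = y
  max x y with x ≤? y
  ... | yes _ = y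
  ... | no  _ = x

  imp : Carrier → Carrier → Carrier
  imp x y with x ≤? y
  ... | yes _ = one
  ... | no  _ = y

  delta : Carrier → Carrier
  delta x with x ≟ one
  ... | yes _ = one
  ... | no  _ = zero

  Interp : Set
  Interp = ℕ → Carrier

  ⟦_⟧ : Fm → Interp → Carrier
  ⟦ var p ⟧ I = I p
  ⟦ ⊥f ⟧ I = zero
  ⟦ ⊤f ⟧ I = one
  ⟦ B ∧f C ⟧ I = min (⟦ B ⟧ I) (⟦ C ⟧ I)
  ⟦ B ∨f C ⟧ I = max (⟦ B ⟧ I) (⟦ C ⟧ I)
  ⟦ B ⇒f C ⟧ I = imp (⟦ B ⟧ I) (⟦ C ⟧ I)
  ⟦ Δf B ⟧ I = delta (⟦ B ⟧ I)

  Valid : Fm → Set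
  Valid A = ∀ (I : Interp) → ⟦ A ⟧ I ≈ one

  RestrictedValid : Fm → Set
  RestrictedValid A = ∀ (I : Interp) → (∀ p → ¬ (I p ≈ one)) → ⟦ A ⟧ I ≈ one

open Sem public

{-# OPTIONS --safe #-}
module Submission where

open import Defs
open import Data.Product using (Σ; _×_; _,_)
open import Relation.Nullary using (¬_; yes; no)
open import Relation.Binary.PropositionalEquality as ≡ using (_≡_)
open import Data.Empty using (⊥-elim)

module _ (T : Chain) where
  open Chain T

  imp-≤ : ∀ {x y} → x ≤ y → imp T x y ≡ one
  imp-≤ {x} {y} x≤y with x ≤? y
  ... | yes _  = ≡.refl
  ... | no x≰y = ⊥-elim (x≰y x≤y)

  imp-≰ : ∀ {x y} → ¬ x ≤ y → imp T x y ≡ y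
  imp-≰ {x} {y} x≰y with x ≤? y
  ... | yes x≤y = ⊥-elim (x≰y x≤y)
  ... | no _    = ≡.refl

  delta-≉one : ∀ {x} → ¬ x ≈ one → delta T x ≡ zero
  delta-≉one {x} x≉one with x ≟ one
  ... | yes x≈one = ⊥-elim (x≉one x≈one)
  ... | no _      = ≡.refl

  delta-one : delta T one ≡ one
  delta-one with one ≟ one
  ... | yes _     = ≡.refl
  ... | no one≉one = ⊥-elim (one≉one Eq.refl)

  one≰zero : ¬ one ≤ zero
  one≰zero one≤zero = zero≉one (antisym (zero-least one) one≤zero)

  ¬Δvar-restrictedValid : ∀ p → RestrictedValid T (¬f (Δf (var p)))
  ¬Δvar-restrictedValid p I I<1 rewrite delta-≉one (I<1 p) =
    Eq.reflexive (imp-≤ (zero-least zero))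

  ¬Δvar-notValid : ∀ p → ¬ Valid T (¬f (Δf (var p)))
  ¬Δvar-notValid p valid with valid (λ _ → one)
  ... | ⟦¬Δp⟧≈one rewrite delta-one | imp-≰ one≰zero = zero≉one ⟦¬Δp⟧≈one

corollary4 : Σ Fm (λ A → ContainsΔ A × ((T : Chain) → RestrictedValid T A) × ((T : Chain) → ¬ Valid T A))
corollary4 =
  ¬f (Δf (var 0)) , ⇒ₗ here , (λ T → ¬Δvar-restrictedValid T 0) , (λ T → ¬Δvar-notValid T 0)
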